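{- Let $q,\ell,m,n \in \mathbb{N}$ with $m,n \geqslant \ell$ and $m+n \geqslant 2\ell+1$. Let $G$ be a bipartite graph with parts $M$ and $N$ of sizes $m$ and $n$ respectively. If $G$ has no $(\ell+1)$-connected subgraph on at least $q$ vertices, then $$e(G) \;\leqslant\; \frac{q(n-\ell)(m-\ell)}{m+n-2\ell} + (\ell^2+\ell)(m+n-2\ell).$$
   Context: $e(G)$ is the number of edges of $G$. A graph on at least $k+1$ vertices is $k$-connected if deleting any set of at most $k-1$ of its vertices leaves a connected graph. -}

module Defs where

open import Data.Nat using (ℕ; zero; suc; _+_; _*_; _∸_; _≤_)
open import Data.Fin using (Fin; zero; suc)
open import Data.Bool using (Bool; true; false; _∧_; not)
open import Data.Sum using (_⊎_; inj₁; inj₂)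
open import Data.Product using (_×_; Σ)
open import Data.Empty using (⊥)
open import Relation.Binary.PropositionalEquality using (_≡_)

count : ∀ {k} → (Fin k → Bool) → ℕ
count {zero}  P = 0
count {suc k} P = (if P zero then 1 else 0) + count (λ i → P (suc i))
  where
  if_then_else_ : Bool → ℕ → ℕ → ℕ
  if true  then a else b = a
  if false then a else b = b

BipGraph : ℕ → ℕ → Set
BipGraph m n = Fin m → Fin n → Bool

Vertex : ℕ → ℕ → Set
Vertex m n = Fin m ⊎ Fin n

VSet : ℕ → ℕ → Set
VSet m n = Vertex m n → Bool

card : ∀ {m n} → VSet m n → ℕ
card {m} {n} S = count (λ i → S (inj₁ i)) + count (λ j → S (inj₂ j))

edges : ∀ {m n} → BipGraph m n → ℕ
edges {m} {n} E = go m (λ i → E i)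
  where
  go : (k : ℕ) → (Fin k → Fin n → Bool) → ℕ
  go zero    F = 0
  go (suc k) F = count (F zero) + go k (λ i → F (suc i))

record Subgraph {m n} (G : BipGraph m n) : Set where
  field
    V     : VSet m n
    F     : BipGraph m n
    F⊆E   : ∀ i j → F i j ≡ true → G i j ≡ true
    F⊆V×V : ∀ i j → F i j ≡ true → (V (inj₁ i) ≡ true) × (V (inj₂ j) ≡ true)

Adj : ∀ {m n} → BipGraph m n → Vertex m n → Vertex m n → Set
Adj F (inj₁ i) (inj₂ j) = F i j ≡ true
Adj F (inj₂ j) (inj₁ i) = F i j ≡ true
Adj F (inj₁ _) (inj₁ _) = ⊥
Adj F (inj₂ _) (inj₂ _) = ⊥

data Walk {m n} (R : VSet m n) (F : BipGraph m n) : Vertex m n → Vertex m n → Set where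
  here : ∀ {u} → R u ≡ true → Walk R F u u
  step : ∀ {u v w} → R u ≡ true → Adj F u v → Walk R F v w → Walk R F u w

Connected : ∀ {m n} → VSet m n → BipGraph m n → Set
Connected R F = ∀ u v → R u ≡ true → R v ≡ true → Walk R F u v

_⊆_ : ∀ {m n} → VSet m n → VSet m n → Set
S ⊆ T = ∀ x → S x ≡ true → T x ≡ true

_∖_ : ∀ {m n} → VSet m n → VSet m n → VSet m n
(V ∖ D) x = V x ∧ not (D x)

KConnected : ∀ {m n} {G : BipGraph m n} → ℕ → Subgraph G → Set
KConnected {m} {n} k H =
  (suc k ≤ card V) ×
  (∀ (D : VSet m n) → D ⊆ V → card D ≤ k ∸ 1 → Connected (V ∖ D) F)
  where open Subgraph H

{-# OPTIONS --safe #-}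

-- Write a = |M| - l and b = |N| - l. The claim is e(G) ≤ q·ab/(a+b) + (l² + l)(a+b), and we prove it
-- for the subgraph induced by any vertex set with l + a vertices in M and l + b in N, by induction
-- on a + b. If a or b is 0, or if the induced subgraph is (l+1)-connected (so it has fewer than q
-- vertices), the trivial bound (l + a)(l + b) suffices. Otherwise either a vertex of degree at most l
-- can be deleted, losing at most l ≤ l² + l edges, or at most l vertices D separate the subgraph
-- into two pieces overlapping in D; as all degrees exceed l, each piece has more than l vertices in
-- both parts, and the induction hypothesis for the pieces adds up because ab/(a+b) is superadditive.

module Submission where

open import Defs
open import Data.Nat
  using (ℕ; zero; suc; _+_; _*_; _∸_; _≤_; _<_; _≤?_; z≤n; s≤s; z<s; NonZero; >-nonZero; >-nonZero⁻¹)
open import Data.Nat.Properties hiding (_≟_)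
open import Data.Nat.Tactic.RingSolver using (solve-∀; solve)
open import Algebra.Properties.CommutativeSemigroup +-commutativeSemigroup using (interchange)
open import Data.Bool using (Bool; true; false; _∧_; _∨_; not)
open import Data.Bool.Properties
  using (∧-identityʳ; ∧-zeroʳ; ∨-identityʳ; ∨-zeroʳ; ∧-conicalˡ; ∧-conicalʳ; ∧-comm; ∨-comm; not-injective)
  renaming (_≟_ to _≟ᵇ_)
open import Data.Fin using (Fin; zero; suc; _≟_)
open import Data.Fin.Properties using (any?)
open import Data.List using (_∷_; [])
open import Data.Product using (Σ; ∃; _×_; _,_; proj₁; proj₂; map)
open import Data.Sum using (_⊎_; inj₁; inj₂; [_,_]′)
import Data.Sum
open import Data.Sum.Properties using (≡-dec; inj₁-injective; inj₂-injective)
open import Data.Empty using (⊥-elim)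
open import Effect.Monad using (RawMonad)
open import Function using (_$_; _∘_; id)
open import Level using (0ℓ)
open import Relation.Binary.Definitions using (DecidableEquality)
open import Relation.Binary.PropositionalEquality
open import Relation.Nullary using (¬_; Dec; does; yes; no; contradiction)
open import Relation.Nullary.Decidable
  using (map′; _×-dec_; dec-true; dec-false; toSum; decidable-stable; ¬¬-excluded-middle)
open import Relation.Nullary.Negation using (¬¬-Monad)

open RawMonad (¬¬-Monad {0ℓ}) using (pure; _>>=_)

-- Arithmetic of the bound

2*[m*n]≤m*m+n*n : ∀ m n → 2 * (m * n) ≤ m * m + n * n
2*[m*n]≤m*m+n*n m n = [ ordered , swapped ]′ (≤-total m n)
  where
  ordered : ∀ {m n} → m ≤ n → 2 * (m * n) ≤ m * m + n * n
  ordered {m} m≤n with t , refl ← m≤n⇒∃[o]m+o≡n m≤n =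
    subst (2 * (m * (m + t)) ≤_) (square-gap m t) (m≤m+n _ (t * t))
    where
    square-gap : ∀ m t → 2 * (m * (m + t)) + t * t ≡ m * m + (m + t) * (m + t)
    square-gap = solve-∀
  swapped : n ≤ m → 2 * (m * n) ≤ m * m + n * n
  swapped n≤m = subst₂ _≤_ (cong (2 *_) (*-comm n m)) (+-comm (n * n) (m * m)) (ordered n≤m)

-- ab/(a+b) is superadditive; cross-multiplied, the gap is (a₁b₂ - a₂b₁)².
product/sum-superadditive : ∀ a₁ b₁ a₂ b₂ →
  (b₁ * a₁ * (a₂ + b₂) + b₂ * a₂ * (a₁ + b₁)) * ((a₁ + a₂) + (b₁ + b₂))
    ≤ (b₁ + b₂) * (a₁ + a₂) * ((a₁ + b₁) * (a₂ + b₂))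
product/sum-superadditive a₁ b₁ a₂ b₂ = +-cancelʳ-≤ (2 * (x * y)) lhs rhs (begin
  lhs + 2 * (x * y)     ≤⟨ +-monoʳ-≤ lhs (2*[m*n]≤m*m+n*n x y) ⟩
  lhs + (x * x + y * y) ≡⟨ gap a₁ b₁ a₂ b₂ ⟩
  rhs + 2 * (x * y)     ∎)
  where
  open ≤-Reasoning
  x = a₁ * b₂
  y = a₂ * b₁
  lhs = (b₁ * a₁ * (a₂ + b₂) + b₂ * a₂ * (a₁ + b₁)) * ((a₁ + a₂) + (b₁ + b₂))
  rhs = (b₁ + b₂) * (a₁ + a₂) * ((a₁ + b₁) * (a₂ + b₂))
  gap : ∀ a₁ b₁ a₂ b₂ →
    (b₁ * a₁ * (a₂ + b₂) + b₂ * a₂ * (a₁ + b₁)) * ((a₁ + a₂) + (b₁ + b₂))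
      + (a₁ * b₂ * (a₁ * b₂) + a₂ * b₁ * (a₂ * b₁))
    ≡ (b₁ + b₂) * (a₁ + a₂) * ((a₁ + b₁) * (a₂ + b₂)) + 2 * (a₁ * b₂ * (a₂ * b₁))
  gap = solve-∀

-- e ≤ q·ab/(a+b) + c·(a+b), cleared of the denominator.
record Bound (q c e a b : ℕ) : Set where
  constructor bound
  field
    ≤-bound : e * (a + b) ≤ q * b * a + c * (a + b) * (a + b)

bound-add : ∀ {q c e₁ e₂ a₁ b₁ a₂ b₂} → .{{NonZero (a₁ + b₁)}} → .{{NonZero (a₂ + b₂)}} →
  Bound q c e₁ a₁ b₁ → Bound q c e₂ a₂ b₂ → Bound q c (e₁ + e₂) (a₁ + a₂) (b₁ + b₂)
bound-add {q} {c} {e₁} {e₂} {a₁} {b₁} {a₂} {b₂} (bound h₁) (bound h₂) =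
  bound $ *-cancelʳ-≤ _ _ ((a₁ + b₁) * (a₂ + b₂)) {{m*n≢0 (a₁ + b₁) (a₂ + b₂)}} (begin
    (e₁ + e₂) * ((a₁ + a₂) + (b₁ + b₂)) * ((a₁ + b₁) * (a₂ + b₂))
      ≡⟨ solve (e₁ ∷ e₂ ∷ a₁ ∷ b₁ ∷ a₂ ∷ b₂ ∷ []) ⟩
    e₁ * (a₁ + b₁) * ((a₂ + b₂) * ((a₁ + a₂) + (b₁ + b₂)))
      + e₂ * (a₂ + b₂) * ((a₁ + b₁) * ((a₁ + a₂) + (b₁ + b₂)))
      ≤⟨ +-mono-≤ (*-monoˡ-≤ _ h₁) (*-monoˡ-≤ _ h₂) ⟩
    (q * b₁ * a₁ + c * (a₁ + b₁) * (a₁ + b₁)) * ((a₂ + b₂) * ((a₁ + a₂) + (b₁ + b₂)))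
      + (q * b₂ * a₂ + c * (a₂ + b₂) * (a₂ + b₂)) * ((a₁ + b₁) * ((a₁ + a₂) + (b₁ + b₂)))
      ≡⟨ solve (q ∷ c ∷ a₁ ∷ b₁ ∷ a₂ ∷ b₂ ∷ []) ⟩
    q * ((b₁ * a₁ * (a₂ + b₂) + b₂ * a₂ * (a₁ + b₁)) * ((a₁ + a₂) + (b₁ + b₂)))
      + c * ((a₁ + a₂) + (b₁ + b₂)) * ((a₁ + a₂) + (b₁ + b₂)) * ((a₁ + b₁) * (a₂ + b₂))
      ≤⟨ +-monoˡ-≤ _ (*-monoʳ-≤ q (product/sum-superadditive a₁ b₁ a₂ b₂)) ⟩
    q * ((b₁ + b₂) * (a₁ + a₂) * ((a₁ + b₁) * (a₂ + b₂)))
      + c * ((a₁ + a₂) + (b₁ + b₂)) * ((a₁ + a₂) + (b₁ + b₂)) * ((a₁ + b₁) * (a₂ + b₂))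
      ≡⟨ solve (q ∷ c ∷ a₁ ∷ b₁ ∷ a₂ ∷ b₂ ∷ []) ⟩
    (q * (b₁ + b₂) * (a₁ + a₂) + c * ((a₁ + a₂) + (b₁ + b₂)) * ((a₁ + a₂) + (b₁ + b₂)))
      * ((a₁ + b₁) * (a₂ + b₂)) ∎)
  where open ≤-Reasoning

bound-mono : ∀ {q c e e′ a b a′ b′} → .{{NonZero (a′ + b′)}} →
  e ≤ e′ → a′ ≤ a → b′ ≤ b → Bound q c e′ a′ b′ → Bound q c e a b
bound-mono {q} {c} {e} {e′} {a} {b} {a′} {b′} e≤e′ a′≤a b′≤b (bound h) = bound $ *-cancelʳ-≤ _ _ (a′ + b′) (begin
  e * (a + b) * (a′ + b′)                               ≤⟨ *-monoˡ-≤ _ (*-monoˡ-≤ _ e≤e′) ⟩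
  e′ * (a + b) * (a′ + b′)                              ≡⟨ solve (e′ ∷ a ∷ b ∷ a′ ∷ b′ ∷ []) ⟩
  e′ * (a′ + b′) * (a + b)                              ≤⟨ *-monoˡ-≤ _ h ⟩
  (q * b′ * a′ + c * (a′ + b′) * (a′ + b′)) * (a + b)
    ≡⟨ solve (q ∷ c ∷ a ∷ b ∷ a′ ∷ b′ ∷ []) ⟩
  q * (b′ * a′ * (a + b)) + c * ((a′ + b′) * (a′ + b′) * (a + b))
    ≤⟨ +-mono-≤ (*-monoʳ-≤ q products) (*-monoʳ-≤ c squares) ⟩
  q * (b * a * (a′ + b′)) + c * ((a + b) * (a + b) * (a′ + b′))
    ≡⟨ solve (q ∷ c ∷ a ∷ b ∷ a′ ∷ b′ ∷ []) ⟩
  (q * b * a + c * (a + b) * (a + b)) * (a′ + b′)       ∎)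
  where
  open ≤-Reasoning
  products : b′ * a′ * (a + b) ≤ b * a * (a′ + b′)
  products = begin
    b′ * a′ * (a + b)         ≡⟨ solve (a ∷ b ∷ a′ ∷ b′ ∷ []) ⟩
    b′ * a′ * a + b′ * a′ * b ≤⟨ +-mono-≤ (*-monoˡ-≤ a (*-monoˡ-≤ a′ b′≤b)) (*-monoˡ-≤ b (*-monoʳ-≤ b′ a′≤a)) ⟩
    b * a′ * a + b′ * a * b   ≡⟨ solve (a ∷ b ∷ a′ ∷ b′ ∷ []) ⟩
    b * a * (a′ + b′)         ∎
  squares : (a′ + b′) * (a′ + b′) * (a + b) ≤ (a + b) * (a + b) * (a′ + b′)
  squares = begin
    (a′ + b′) * (a′ + b′) * (a + b) ≤⟨ *-monoˡ-≤ (a + b) (*-monoˡ-≤ (a′ + b′) (+-mono-≤ a′≤a b′≤b)) ⟩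
    (a + b) * (a′ + b′) * (a + b)   ≡⟨ solve (a ∷ b ∷ a′ ∷ b′ ∷ []) ⟩
    (a + b) * (a + b) * (a′ + b′)   ∎

bound-split : ∀ {q c e e₁ e₂ a b a₁ b₁ a₂ b₂} → .{{NonZero (a₁ + b₁)}} → .{{NonZero (a₂ + b₂)}} →
  e ≤ e₁ + e₂ → a₁ + a₂ ≤ a → b₁ + b₂ ≤ b →
  Bound q c e₁ a₁ b₁ → Bound q c e₂ a₂ b₂ → Bound q c e a b
bound-split {a₁ = a₁} {b₁} {a₂} {b₂} e≤ a≤ b≤ h₁ h₂ =
  bound-mono {{>-nonZero (<-≤-trans (>-nonZero⁻¹ (a₁ + b₁)) (+-mono-≤ (m≤m+n a₁ a₂) (m≤m+n b₁ b₂)))}}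
    e≤ a≤ b≤ (bound-add h₁ h₂)

bound-single : ∀ {q c d} → d ≤ c → Bound q c d 1 0 × Bound q c d 0 1
bound-single {q} {c} {d} d≤c = bound (subst₂ _≤_ (sym (*-identityʳ d)) (unit₁ q c) d≤c)
                             , bound (subst₂ _≤_ (sym (*-identityʳ d)) (unit₂ q c) d≤c)
  where
  unit₁ : ∀ q c → c ≡ q * 0 * 1 + c * 1 * 1
  unit₁ = solve-∀
  unit₂ : ∀ q c → c ≡ q * 1 * 0 + c * 1 * 1
  unit₂ = solve-∀

bound-extendˡ : ∀ {q c e e′ d a b} → .{{NonZero (a + b)}} →
  e ≤ e′ + d → d ≤ c → Bound q c e′ a b → Bound q c e (suc a) b
bound-extendˡ {a = a} {b} e≤ d≤c h =
  bound-split e≤ (≤-reflexive (+-comm a 1)) (≤-reflexive (+-identityʳ b)) h (proj₁ (bound-single d≤c))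

bound-extendʳ : ∀ {q c e e′ d a b} → .{{NonZero (a + b)}} →
  e ≤ e′ + d → d ≤ c → Bound q c e′ a b → Bound q c e a (suc b)
bound-extendʳ {a = a} {b} e≤ d≤c h =
  bound-split e≤ (≤-reflexive (+-identityʳ a)) (≤-reflexive (+-comm b 1)) h (proj₂ (bound-single d≤c))

bound-product : ∀ {q l e a b} → .{{NonZero (a + b)}} →
  e ≤ (l + a) * (l + b) → a * b ≡ 0 ⊎ a + b ≤ q → Bound q (l * l + l) e a b
bound-product {q} {l} {e} {a} {b} e≤ thin-or-small = bound (begin
  e * (a + b)                                                 ≤⟨ *-monoˡ-≤ (a + b) e≤ ⟩
  (l + a) * (l + b) * (a + b)                                 ≡⟨ solve (l ∷ a ∷ b ∷ []) ⟩
  l * l * (a + b) + l * (a + b) * (a + b) + a * b * (a + b)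
    ≤⟨ +-mono-≤ (+-monoˡ-≤ _ (m≤m*n (l * l * (a + b)) (a + b))) (products thin-or-small) ⟩
  l * l * (a + b) * (a + b) + l * (a + b) * (a + b) + q * b * a ≡⟨ solve (q ∷ l ∷ a ∷ b ∷ []) ⟩
  q * b * a + (l * l + l) * (a + b) * (a + b)                 ∎)
  where
  open ≤-Reasoning
  products : a * b ≡ 0 ⊎ a + b ≤ q → a * b * (a + b) ≤ q * b * a
  products (inj₁ ab≡0) rewrite ab≡0 = z≤n
  products (inj₂ a+b≤q) = begin
    a * b * (a + b) ≤⟨ *-monoʳ-≤ (a * b) a+b≤q ⟩
    a * b * q       ≡⟨ solve (q ∷ a ∷ b ∷ []) ⟩
    q * b * a       ∎

bound? : ∀ {q c e a b} → Dec (Bound q c e a b)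
bound? = map′ bound Bound.≤-bound (_ ≤? _)

excess : ∀ {l x} → suc l ≤ x → ∃ λ a → x ≡ l + suc a
excess {l} {x} l<x = x ∸ suc l , sym (trans (+-suc l (x ∸ suc l)) (m+[n∸m]≡n l<x))

overlap-≤ : ∀ {l x y z d} → (l + x) + (l + y) ≡ (l + z) + d → d ≤ l → x + y ≤ z
overlap-≤ {l} {x} {y} {z} {d} eq d≤l = +-cancelʳ-≤ (l + l) (x + y) z (begin
  (x + y) + (l + l) ≡⟨ solve (l ∷ x ∷ y ∷ []) ⟩
  (l + x) + (l + y) ≡⟨ eq ⟩
  (l + z) + d       ≤⟨ +-monoʳ-≤ (l + z) d≤l ⟩
  (l + z) + l       ≡⟨ solve (l ∷ z ∷ []) ⟩
  z + (l + l)       ∎)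
  where open ≤-Reasoning

pieces-smaller : ∀ {a b a₁ b₁ a₂ b₂} → .{{NonZero a₁}} → .{{NonZero a₂}} →
  a₁ + a₂ ≤ a → b₁ + b₂ ≤ b → a₁ + b₁ < a + b × a₂ + b₂ < a + b
pieces-smaller {a₁ = a₁} {b₁} {a₂} {b₂} a≤ b≤ =
    <-≤-trans (+-mono-<-≤ (m<m+n a₁ (>-nonZero⁻¹ a₂)) (m≤m+n b₁ b₂)) (+-mono-≤ a≤ b≤)
  , <-≤-trans (+-mono-<-≤ (m<n+m a₂ (>-nonZero⁻¹ a₁)) (m≤n+m b₂ b₁)) (+-mono-≤ a≤ b≤)

m+n∸2*l≡[m∸l]+[n∸l] : ∀ {l m n} → l ≤ m → l ≤ n → m + n ∸ 2 * l ≡ (m ∸ l) + (n ∸ l)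
m+n∸2*l≡[m∸l]+[n∸l] {l} {m} {n} l≤m l≤n = begin
  m + n ∸ 2 * l     ≡⟨ cong (λ k → m + n ∸ (l + k)) (+-identityʳ l) ⟩
  m + n ∸ (l + l)   ≡⟨ ∸-+-assoc (m + n) l l ⟨
  m + n ∸ l ∸ l     ≡⟨ cong (_∸ l) (+-∸-comm n l≤m) ⟩
  (m ∸ l) + n ∸ l   ≡⟨ +-∸-assoc (m ∸ l) l≤n ⟩
  (m ∸ l) + (n ∸ l) ∎
  where open ≡-Reasoning

-- Counting

∨-true : ∀ {a b} → a ≡ true ⊎ b ≡ true → a ∨ b ≡ true
∨-true     (inj₁ refl) = refl
∨-true {a} (inj₂ refl) = ∨-zeroʳ a

count-cong : ∀ {k} {f g : Fin k → Bool} → (∀ i → f i ≡ g i) → count f ≡ count g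
count-cong {zero}  f≗g = refl
count-cong {suc k} f≗g rewrite f≗g zero = cong₂ _+_ refl (count-cong (λ i → f≗g (suc i)))

count-mono : ∀ {k} {f g : Fin k → Bool} → (∀ i → f i ≡ true → g i ≡ true) → count f ≤ count g
count-mono {zero} f⊆g = z≤n
count-mono {suc k} {f} {g} f⊆g with f zero in f₀ | g zero in g₀
... | false | false = count-mono (λ i → f⊆g (suc i))
... | false | true  = m≤n⇒m≤1+n (count-mono (λ i → f⊆g (suc i)))
... | true  | true  = s≤s (count-mono (λ i → f⊆g (suc i)))
... | true  | false with () ← trans (sym (f⊆g zero f₀)) g₀

count-false : ∀ {k} → count {k} (λ _ → false) ≡ 0
count-false {zero}  = refl
count-false {suc k} = count-false {k}

count-true : ∀ {k} → count {k} (λ _ → true) ≡ k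
count-true {zero}  = refl
count-true {suc k} = cong suc (count-true {k})

count-∨+∧ : ∀ {k} (f g : Fin k → Bool) →
  count (λ i → f i ∨ g i) + count (λ i → f i ∧ g i) ≡ count f + count g
count-∨+∧ {zero} f g = refl
count-∨+∧ {suc k} f g with f zero | g zero | count-∨+∧ (λ i → f (suc i)) (λ i → g (suc i))
... | false | false | ih = ih
... | false | true  | ih = trans (cong suc ih) (sym (+-suc _ _))
... | true  | false | ih = cong suc ih
... | true  | true  | ih = cong suc (trans (+-suc _ _) (trans (cong suc ih) (sym (+-suc _ _))))

count-singleton : ∀ {k} (i : Fin k) → count (λ j → does (j ≟ i)) ≡ 1
count-singleton {suc k} zero = cong suc (count-false {k})
count-singleton (suc i) = count-singleton i

count-∧+∧not : ∀ {k} (f g : Fin k → Bool) →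
  count (λ i → f i ∧ g i) + count (λ i → f i ∧ not (g i)) ≡ count f
count-∧+∧not {zero} f g = refl
count-∧+∧not {suc k} f g with f zero | g zero | count-∧+∧not (λ i → f (suc i)) (λ i → g (suc i))
... | false | _     | ih = ih
... | true  | true  | ih = cong suc ih
... | true  | false | ih = trans (+-suc _ _) (cong suc ih)

count-remove : ∀ {k} (f : Fin k → Bool) {i} → f i ≡ true →
  suc (count (λ j → f j ∧ not (does (j ≟ i)))) ≡ count f
count-remove f {i} fi = begin
  suc rest                                ≡⟨ cong (_+ rest) (count-singleton i) ⟨
  count (λ j → does (j ≟ i)) + rest       ≡⟨ cong (_+ rest) (count-cong at-i) ⟩
  count (λ j → f j ∧ does (j ≟ i)) + rest ≡⟨ count-∧+∧not f (λ j → does (j ≟ i)) ⟩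
  count f                                 ∎
  where
  open ≡-Reasoning
  rest = count (λ j → f j ∧ not (does (j ≟ i)))
  at-i : ∀ j → does (j ≟ i) ≡ f j ∧ does (j ≟ i)
  at-i j with j ≟ i
  ... | yes refl = sym (cong (_∧ true) fi)
  ... | no _     = sym (∧-zeroʳ (f j))

count-witness : ∀ {k} {f g : Fin k → Bool} → count g < count f → ∃ λ i → f i ≡ true × g i ≡ false
count-witness {suc k} {f} {g} g<f with f zero in f₀ | g zero in g₀
... | true  | false = zero , f₀ , g₀
... | true  | true  = map suc id (count-witness {f = f ∘ suc} {g ∘ suc} (≤-pred g<f))
... | false | false = map suc id (count-witness {f = f ∘ suc} {g ∘ suc} g<f)
... | false | true  = map suc id (count-witness {f = f ∘ suc} {g ∘ suc} (<-trans (n<1+n _) g<f))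

edges-cover : ∀ {m n} {E E₁ E₂ : BipGraph m n} →
  (∀ i j → E i j ≡ true → E₁ i j ≡ true ⊎ E₂ i j ≡ true) → edges E ≤ edges E₁ + edges E₂
edges-cover {zero} cover = z≤n
edges-cover {suc m} {E = E} {E₁} {E₂} cover = begin
  count (E zero) + edges (λ i → E (suc i))
    ≤⟨ +-mono-≤ row (edges-cover (λ i → cover (suc i))) ⟩
  (count (E₁ zero) + count (E₂ zero)) + (edges (λ i → E₁ (suc i)) + edges (λ i → E₂ (suc i)))
    ≡⟨ interchange (count (E₁ zero)) (count (E₂ zero)) _ _ ⟩
  edges E₁ + edges E₂ ∎
  where
  open ≤-Reasoning
  row : count (E zero) ≤ count (E₁ zero) + count (E₂ zero)
  row = begin
    count (E zero)                      ≤⟨ count-mono (λ j e → ∨-true (cover zero j e)) ⟩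
    count (λ j → E₁ zero j ∨ E₂ zero j) ≤⟨ m≤m+n _ _ ⟩
    _                                   ≡⟨ count-∨+∧ (E₁ zero) (E₂ zero) ⟩
    count (E₁ zero) + count (E₂ zero)   ∎

edges-≤-product : ∀ {m n} {E : BipGraph m n} (f : Fin m → Bool) (g : Fin n → Bool) →
  (∀ i j → E i j ≡ true → f i ≡ true × g j ≡ true) → edges E ≤ count f * count g
edges-≤-product {zero} f g E⊆f×g = z≤n
edges-≤-product {suc m} {n} f g E⊆f×g with f zero in f₀
... | true  = +-mono-≤ (count-mono (λ j e → proj₂ (E⊆f×g zero j e)))
                       (edges-≤-product (f ∘ suc) g (λ i → E⊆f×g (suc i)))
... | false = +-mono-≤ (≤-trans (count-mono (λ j e → trans (sym f₀) (proj₁ (E⊆f×g zero j e))))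
                                (≤-reflexive (count-false {n})))
                       (edges-≤-product (f ∘ suc) g (λ i → E⊆f×g (suc i)))

-- Vertex sets and walks

private
  variable
    m n : ℕ

_≟ᵛ_ : DecidableEquality (Vertex m n)
_≟ᵛ_ = ≡-dec _≟_ _≟_

⁅_⁆ : Vertex m n → VSet m n
⁅ v ⁆ x = does (x ≟ᵛ v)

_∪_ : VSet m n → VSet m n → VSet m n
(A ∪ B) x = A x ∨ B x

_∩_ : VSet m n → VSet m n → VSet m n
(A ∩ B) x = A x ∧ B x

card₁ : VSet m n → ℕ
card₁ S = count (λ i → S (inj₁ i))

card₂ : VSet m n → ℕ
card₂ S = count (λ j → S (inj₂ j))

∖-⊆ : ∀ {S D : VSet m n} → (S ∖ D) ⊆ S
∖-⊆ {S = S} x = ∧-conicalˡ (S x) _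

∖-intro : ∀ {S D : VSet m n} {x} → S x ≡ true → D x ≡ false → (S ∖ D) x ≡ true
∖-intro Sx Dx rewrite Sx | Dx = refl

∖⁅⁆-intro : ∀ {S : VSet m n} {v x} → S x ≡ true → x ≢ v → (S ∖ ⁅ v ⁆) x ≡ true
∖⁅⁆-intro {v = v} {x} Sx x≢v rewrite Sx | dec-false (x ≟ᵛ v) x≢v = refl

∖⁅⁆-self : ∀ {S : VSet m n} v → (S ∖ ⁅ v ⁆) v ≡ false
∖⁅⁆-self {S = S} v rewrite dec-true (v ≟ᵛ v) refl = ∧-zeroʳ (S v)

card₁-∖⁅inj₁⁆ : ∀ {S : VSet m n} {i} → S (inj₁ i) ≡ true → suc (card₁ (S ∖ ⁅ inj₁ i ⁆)) ≡ card₁ S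
card₁-∖⁅inj₁⁆ {S = S} = count-remove (λ i → S (inj₁ i))

card₂-∖⁅inj₁⁆ : ∀ {S : VSet m n} {i} → card₂ (S ∖ ⁅ inj₁ i ⁆) ≡ card₂ S
card₂-∖⁅inj₁⁆ {S = S} = count-cong (λ j → ∧-identityʳ (S (inj₂ j)))

card₁-∖⁅inj₂⁆ : ∀ {S : VSet m n} {j} → card₁ (S ∖ ⁅ inj₂ j ⁆) ≡ card₁ S
card₁-∖⁅inj₂⁆ {S = S} = count-cong (λ i → ∧-identityʳ (S (inj₁ i)))

card₂-∖⁅inj₂⁆ : ∀ {S : VSet m n} {j} → S (inj₂ j) ≡ true → suc (card₂ (S ∖ ⁅ inj₂ j ⁆)) ≡ card₂ S
card₂-∖⁅inj₂⁆ {S = S} = count-remove (λ j → S (inj₂ j))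

card-∖⁅⁆ : ∀ {S : VSet m n} {v} → S v ≡ true → suc (card (S ∖ ⁅ v ⁆)) ≡ card S
card-∖⁅⁆ {S = S} {inj₁ i} Sv = cong₂ _+_ (card₁-∖⁅inj₁⁆ {S = S} {i} Sv) (card₂-∖⁅inj₁⁆ {S = S} {i})
card-∖⁅⁆ {S = S} {inj₂ j} Sv =
  trans (sym (+-suc _ _)) (cong₂ _+_ (card₁-∖⁅inj₂⁆ {S = S} {j}) (card₂-∖⁅inj₂⁆ {S = S} {j} Sv))

adj-sym : ∀ {F : BipGraph m n} {x y} → Adj F x y → Adj F y x
adj-sym {x = inj₁ _} {inj₂ _} e = e
adj-sym {x = inj₂ _} {inj₁ _} e = e

adjacent? : ∀ {F : BipGraph m n} {p} {P : Vertex m n → Set p} →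
  (∀ v → Dec (P v)) → ∀ u → Dec (∃ λ v → Adj F u v × P v)
adjacent? {F = F} P? (inj₁ i) = map′ (λ (j , e , p) → inj₂ j , e , p) (λ { (inj₂ j , e , p) → j , e , p })
  (any? λ j → (F i j ≟ᵇ true) ×-dec P? (inj₂ j))
adjacent? {F = F} P? (inj₂ j) = map′ (λ (i , e , p) → inj₁ i , e , p) (λ { (inj₁ i , e , p) → i , e , p })
  (any? λ i → (F i j ≟ᵇ true) ×-dec P? (inj₁ i))

module _ {S : VSet m n} {F : BipGraph m n} where

  walk-start : ∀ {u w} → Walk S F u w → S u ≡ true
  walk-start (here Su)     = Su
  walk-start (step Su _ _) = Su

  walk-end : ∀ {u w} → Walk S F u w → S w ≡ true
  walk-end (here Sw)       = Sw
  walk-end (step _ _ rest) = walk-end rest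

  walk-snoc : ∀ {u v w} → Walk S F u v → S w ≡ true → Adj F v w → Walk S F u w
  walk-snoc (here Sv)        Sw e = step Sv e (here Sw)
  walk-snoc (step Su e′ rest) Sw e = step Su e′ (walk-snoc rest Sw e)

  walk-mono : ∀ {T u w} → S ⊆ T → Walk S F u w → Walk T F u w
  walk-mono S⊆T (here Su)        = here (S⊆T _ Su)
  walk-mono S⊆T (step Su e rest) = step (S⊆T _ Su) e (walk-mono S⊆T rest)

  last-exit : ∀ {u x w} → u ≢ w → Walk S F x w →
    Walk (S ∖ ⁅ u ⁆) F x w ⊎ ∃ λ v → Adj F u v × Walk (S ∖ ⁅ u ⁆) F v w
  last-exit u≢w (here Sw) = inj₁ (here (∖⁅⁆-intro {S = S} Sw (u≢w ∘ sym)))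
  last-exit {u} u≢w (step {x} {y} Sx e rest) with last-exit u≢w rest | x ≟ᵛ u
  ... | inj₂ exit  | _        = inj₂ exit
  ... | inj₁ avoid | yes refl = inj₂ (y , e , avoid)
  ... | inj₁ avoid | no x≢u   = inj₁ (step (∖⁅⁆-intro {S = S} Sx x≢u) e avoid)

walk-bounded? : ∀ k {S : VSet m n} {F} → card S < k → ∀ u w → Dec (Walk S F u w)
walk-bounded? (suc k) {S} {F} |S|<k u w with S u in Su | u ≟ᵛ w
... | false | _        = no (λ walk → contradiction (trans (sym (walk-start walk)) Su) λ ())
... | true  | yes refl = yes (here Su)
... | true  | no u≢w   = map′ from-neighbour to-neighbour (adjacent? (λ v → walk-bounded? k smaller v w) u)
  where
  smaller : card (S ∖ ⁅ u ⁆) < k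
  smaller = subst (_≤ k) (sym (card-∖⁅⁆ {S = S} {u} Su)) (≤-pred |S|<k)
  from-neighbour : (∃ λ v → Adj F u v × Walk (S ∖ ⁅ u ⁆) F v w) → Walk S F u w
  from-neighbour (v , e , rest) = step Su e (walk-mono ∖-⊆ rest)
  to-neighbour : Walk S F u w → ∃ λ v → Adj F u v × Walk (S ∖ ⁅ u ⁆) F v w
  to-neighbour walk with last-exit u≢w walk
  ... | inj₂ exit  = exit
  ... | inj₁ avoid = contradiction (trans (sym (walk-start avoid)) (∖⁅⁆-self {S = S} u)) λ ()

walk? : ∀ (S : VSet m n) F u w → Dec (Walk S F u w)
walk? S F = walk-bounded? (suc (card S)) ≤-refl

-- Induced subgraphs, separations and cuts

module _ {m n} (G : BipGraph m n) where

  induced : VSet m n → BipGraph m n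
  induced V i j = V (inj₁ i) ∧ V (inj₂ j) ∧ G i j

  induced-elim : ∀ V {i j} → induced V i j ≡ true → V (inj₁ i) ≡ true × V (inj₂ j) ≡ true × G i j ≡ true
  induced-elim V {i} {j} e with V (inj₁ i) | V (inj₂ j) | G i j | e
  ... | true | true | true | _ = refl , refl , refl

  induced-intro : ∀ V {i j} → V (inj₁ i) ≡ true → V (inj₂ j) ≡ true → G i j ≡ true → induced V i j ≡ true
  induced-intro V Vi Vj Gij rewrite Vi | Vj = Gij

  adj-induced : ∀ V {x y} → Adj (induced V) x y → V x ≡ true × V y ≡ true
  adj-induced V {inj₁ i} {inj₂ j} e = proj₁ (induced-elim V e) , proj₁ (proj₂ (induced-elim V e))
  adj-induced V {inj₂ j} {inj₁ i} e = proj₁ (proj₂ (induced-elim V e)) , proj₁ (induced-elim V e)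

  inducedSubgraph : VSet m n → Subgraph G
  inducedSubgraph V = record
    { V = V ; F = induced V
    ; F⊆E   = λ i j e → proj₂ (proj₂ (induced-elim V e))
    ; F⊆V×V = λ i j e → proj₁ (induced-elim V e) , proj₁ (proj₂ (induced-elim V e)) }

  degree : VSet m n → Vertex m n → ℕ
  degree V (inj₁ i) = count (induced V i)
  degree V (inj₂ j) = count (λ i → induced V i j)

  edges-induced-≤-product : ∀ V → edges (induced V) ≤ card₁ V * card₂ V
  edges-induced-≤-product V = edges-≤-product (λ i → V (inj₁ i)) (λ j → V (inj₂ j))
    (λ i j e → proj₁ (induced-elim V e) , proj₁ (proj₂ (induced-elim V e)))

  edges-induced-∖⁅⁆ : ∀ V v → edges (induced V) ≤ edges (induced (V ∖ ⁅ v ⁆)) + degree V v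
  edges-induced-∖⁅⁆ V (inj₁ i₀) = ≤-trans (edges-cover cover) (+-monoʳ-≤ _ star)
    where
    star : edges (λ i j → does (i ≟ i₀) ∧ induced V i j) ≤ count (induced V i₀)
    star = ≤-trans (edges-≤-product (λ i → does (i ≟ i₀)) (induced V i₀) at-i₀)
                   (≤-reflexive (trans (cong (_* count (induced V i₀)) (count-singleton i₀)) (+-identityʳ _)))
      where
      at-i₀ : ∀ i j → does (i ≟ i₀) ∧ induced V i j ≡ true → does (i ≟ i₀) ≡ true × induced V i₀ j ≡ true
      at-i₀ i j e with i ≟ i₀
      ... | yes refl = refl , e
    cover : ∀ i j → induced V i j ≡ true →
      induced (V ∖ ⁅ inj₁ i₀ ⁆) i j ≡ true ⊎ does (i ≟ i₀) ∧ induced V i j ≡ true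
    cover i j e = [ on-star , off-star ]′ (toSum (i ≟ i₀))
      where
      on-star : i ≡ i₀ → _
      on-star i≡i₀ = inj₂ (trans (cong (_∧ induced V i j) (dec-true (i ≟ i₀) i≡i₀)) e)
      off-star : i ≢ i₀ → _
      off-star i≢i₀ = let Vi , Vj , Gij = induced-elim V e in
        inj₁ (induced-intro (V ∖ ⁅ inj₁ i₀ ⁆) (∖⁅⁆-intro {S = V} Vi (i≢i₀ ∘ inj₁-injective))
                                              (∖⁅⁆-intro {S = V} {inj₁ i₀} Vj λ ()) Gij)
  edges-induced-∖⁅⁆ V (inj₂ j₀) = ≤-trans (edges-cover cover) (+-monoʳ-≤ _ star)
    where
    star : edges (λ i j → does (j ≟ j₀) ∧ induced V i j) ≤ count (λ i → induced V i j₀)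
    star = ≤-trans (edges-≤-product (λ i → induced V i j₀) (λ j → does (j ≟ j₀)) at-j₀)
                   (≤-reflexive (trans (cong (count (λ i → induced V i j₀) *_) (count-singleton j₀)) (*-identityʳ _)))
      where
      at-j₀ : ∀ i j → does (j ≟ j₀) ∧ induced V i j ≡ true → induced V i j₀ ≡ true × does (j ≟ j₀) ≡ true
      at-j₀ i j e with j ≟ j₀
      ... | yes refl = e , refl
    cover : ∀ i j → induced V i j ≡ true →
      induced (V ∖ ⁅ inj₂ j₀ ⁆) i j ≡ true ⊎ does (j ≟ j₀) ∧ induced V i j ≡ true
    cover i j e = [ on-star , off-star ]′ (toSum (j ≟ j₀))
      where
      on-star : j ≡ j₀ → _
      on-star j≡j₀ = inj₂ (trans (cong (_∧ induced V i j) (dec-true (j ≟ j₀) j≡j₀)) e)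
      off-star : j ≢ j₀ → _
      off-star j≢j₀ = let Vi , Vj , Gij = induced-elim V e in
        inj₁ (induced-intro (V ∖ ⁅ inj₂ j₀ ⁆) (∖⁅⁆-intro {S = V} {inj₂ j₀} Vi λ ())
                                              (∖⁅⁆-intro {S = V} Vj (j≢j₀ ∘ inj₂-injective)) Gij)

  MinDegree : VSet m n → ℕ → Set
  MinDegree V k = ∀ x → V x ≡ true → k ≤ degree V x

  record Separation (V : VSet m n) (k : ℕ) : Set where
    field
      A B        : VSet m n
      A∪B≡V      : ∀ x → (A ∪ B) x ≡ V x
      A∖B-closed : ∀ {x y} → Adj (induced V) x y → A x ≡ true → B x ≡ false → A y ≡ true
      |A∩B|≤k    : card (A ∩ B) ≤ k
      u w        : Vertex m n
      u∈A∖B      : A u ≡ true × B u ≡ false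
      w∈B∖A      : B w ≡ true × A w ≡ false

  module _ {V k} (σ : Separation V k) where
    open Separation σ

    ∈A⊎∈B : ∀ {x} → V x ≡ true → A x ≡ true ⊎ B x ≡ true
    ∈A⊎∈B {x} Vx with A x in Ax
    ... | true  = inj₁ refl
    ... | false = inj₂ (trans (cong (_∨ B x) (sym Ax)) (trans (A∪B≡V x) Vx))

    B∖A-closed : ∀ {x y} → Adj (induced V) x y → B x ≡ true → A x ≡ false → B y ≡ true
    B∖A-closed {x} {y} e Bx Ax with B y in By | ∈A⊎∈B (proj₂ (adj-induced V e))
    ... | true  | _      = refl
    ... | false | inj₁ Ay = contradiction (trans (sym (A∖B-closed (adj-sym e) Ay By)) Ax) λ ()

    swap : Separation V k
    swap = record
      { A = B ; B = A
      ; A∪B≡V = λ x → trans (∨-comm (B x) (A x)) (A∪B≡V x)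
      ; A∖B-closed = B∖A-closed
      ; |A∩B|≤k = ≤-trans (≤-reflexive (cong₂ _+_ (count-cong (λ i → ∧-comm (B (inj₁ i)) (A (inj₁ i))))
                                                   (count-cong (λ j → ∧-comm (B (inj₂ j)) (A (inj₂ j))))))
                          |A∩B|≤k
      ; u = w ; w = u ; u∈A∖B = w∈B∖A ; w∈B∖A = u∈A∖B }

    edge-within : ∀ {x y} → Adj (induced V) x y → (A x ≡ true × A y ≡ true) ⊎ (B x ≡ true × B y ≡ true)
    edge-within {x} {y} e with A x in Ax | B x in Bx
    ... | true  | false = inj₁ (refl , A∖B-closed e Ax Bx)
    ... | false | true  = inj₂ (refl , B∖A-closed e Bx Ax)
    ... | true  | true  =
      [ (λ Ay → inj₁ (refl , Ay)) , (λ By → inj₂ (refl , By)) ]′ (∈A⊎∈B (proj₂ (adj-induced V e)))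
    ... | false | false =
      contradiction (trans (trans (sym (cong₂ _∨_ Ax Bx)) (A∪B≡V x)) (proj₁ (adj-induced V e))) λ ()

    edges-induced-≤-sides : edges (induced V) ≤ edges (induced A) + edges (induced B)
    edges-induced-≤-sides = edges-cover λ i j e → let _ , _ , Gij = induced-elim V e in
      Data.Sum.map (λ (Ai , Aj) → induced-intro A Ai Aj Gij) (λ (Bi , Bj) → induced-intro B Bi Bj Gij)
                   (edge-within {inj₁ i} {inj₂ j} e)

    A⊆V : A ⊆ V
    A⊆V x Ax = trans (sym (A∪B≡V x)) (cong (_∨ B x) Ax)

    card₁-sides : card₁ A + card₁ B ≡ card₁ V + card₁ (A ∩ B)
    card₁-sides = trans (sym (count-∨+∧ (λ i → A (inj₁ i)) (λ i → B (inj₁ i))))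
                        (cong (_+ card₁ (A ∩ B)) (count-cong (λ i → A∪B≡V (inj₁ i))))

    card₂-sides : card₂ A + card₂ B ≡ card₂ V + card₂ (A ∩ B)
    card₂-sides = trans (sym (count-∨+∧ (λ j → A (inj₂ j)) (λ j → B (inj₂ j))))
                        (cong (_+ card₂ (A ∩ B)) (count-cong (λ j → A∪B≡V (inj₂ j))))

    -- A vertex of A ∖ B has more than k neighbours, all in A; as at most k of them lie in A ∩ B,
    -- one of them is a vertex of A ∖ B on the other side, which has more than k neighbours in A too.
    sides-large : MinDegree V (suc k) → suc k ≤ card₁ A × suc k ≤ card₂ A
    sides-large δ = from u u∈A∖B
      where
      spread₁ : ∀ {i} → A (inj₁ i) ≡ true → B (inj₁ i) ≡ false →
        suc k ≤ card₂ A × ∃ λ j → A (inj₂ j) ≡ true × B (inj₂ j) ≡ false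
      spread₁ {i} Ai Bi =
        ≤-trans deg (count-mono {f = induced V i} (λ j e → A∖B-closed {inj₁ i} {inj₂ j} e Ai Bi)) , (j , Aj , Bj)
        where
        deg = δ (inj₁ i) (A⊆V _ Ai)
        witness = count-witness {f = induced V i} {g = λ j → (A ∩ B) (inj₂ j)}
                                (≤-trans (s≤s (≤-trans (m≤n+m _ _) |A∩B|≤k)) deg)
        j = proj₁ witness
        Aj = A∖B-closed (proj₁ (proj₂ witness)) Ai Bi
        Bj = trans (sym (cong (_∧ B (inj₂ j)) Aj)) (proj₂ (proj₂ witness))
      spread₂ : ∀ {j} → A (inj₂ j) ≡ true → B (inj₂ j) ≡ false →
        suc k ≤ card₁ A × ∃ λ i → A (inj₁ i) ≡ true × B (inj₁ i) ≡ false
      spread₂ {j} Aj Bj =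
        ≤-trans deg (count-mono {f = λ i → induced V i j} (λ i e → A∖B-closed {inj₂ j} {inj₁ i} e Aj Bj)) , (i , Ai , Bi)
        where
        deg = δ (inj₂ j) (A⊆V _ Aj)
        witness = count-witness {f = λ i → induced V i j} {g = λ i → (A ∩ B) (inj₁ i)}
                                (≤-trans (s≤s (≤-trans (m≤m+n _ _) |A∩B|≤k)) deg)
        i = proj₁ witness
        Ai = A∖B-closed {inj₂ j} (proj₁ (proj₂ witness)) Aj Bj
        Bi = trans (sym (cong (_∧ B (inj₁ i)) Ai)) (proj₂ (proj₂ witness))
      from : ∀ x → A x ≡ true × B x ≡ false → suc k ≤ card₁ A × suc k ≤ card₂ A
      from (inj₁ i) (Ai , Bi) = let k<|A₂| , j , Aj , Bj = spread₁ Ai Bi in proj₁ (spread₂ Aj Bj) , k<|A₂|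
      from (inj₂ j) (Aj , Bj) = let k<|A₁| , i , Ai , Bi = spread₂ Aj Bj in k<|A₁| , proj₁ (spread₁ Ai Bi)

  record VertexCut (V : VSet m n) (k : ℕ) : Set where
    field
      D     : VSet m n
      D⊆V   : D ⊆ V
      |D|≤k : card D ≤ k
      u w   : Vertex m n
      u∈V∖D : (V ∖ D) u ≡ true
      w∈V∖D : (V ∖ D) w ≡ true
      u↮w   : ¬ Walk (V ∖ D) (induced V) u w

  kConnected : ∀ {V k} → suc k ≤ card V → ¬ VertexCut V (k ∸ 1) → KConnected k (inducedSubgraph V)
  kConnected {V} large ¬cut = large , λ D D⊆V |D|≤k u w u∈V∖D w∈V∖D →
    decidable-stable (walk? (V ∖ D) (induced V) u w) λ u↮w → ¬cut (record
      { D = D ; D⊆V = D⊆V ; |D|≤k = |D|≤k ; u = u ; w = w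
      ; u∈V∖D = u∈V∖D ; w∈V∖D = w∈V∖D ; u↮w = u↮w })

  private
    cut-bits : ∀ v d c → (d ≡ true → v ≡ true) → (c ≡ true → v ∧ not d ≡ true) →
      (c ∨ d) ∨ (v ∧ not c) ≡ v × (c ∨ d) ∧ (v ∧ not c) ≡ d
    cut-bits true  true  true  _   C⊆V with () ← C⊆V refl
    cut-bits true  true  false _   _   = refl , refl
    cut-bits true  false true  _   _   = refl , refl
    cut-bits true  false false _   _   = refl , refl
    cut-bits false true  _     D⊆V _   with () ← D⊆V refl
    cut-bits false false true  _   C⊆V with () ← C⊆V refl
    cut-bits false false false _   _   = refl , refl

  -- A is the component of u in V ∖ D together with D, and B is the rest of V.
  separation : ∀ {V k} → VertexCut V k → Separation V k
  separation {V} {k} cut = record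
    { A = C ∪ D
    ; B = λ x → V x ∧ not (C x)
    ; A∪B≡V = λ x → proj₁ (bits x)
    ; A∖B-closed = closed
    ; |A∩B|≤k = ≤-trans (≤-reflexive (cong₂ _+_ (count-cong (λ i → proj₂ (bits (inj₁ i))))
                                                 (count-cong (λ j → proj₂ (bits (inj₂ j))))))
                        |D|≤k
    ; u = u ; u∈A∖B = cong (_∨ D u) Cu , trans (cong (λ c → V u ∧ not c) Cu) (∧-zeroʳ (V u))
    ; w = w ; w∈B∖A = trans (cong (λ c → V w ∧ not c) Cw) (trans (∧-identityʳ (V w)) (∖-⊆ {S = V} {D} w w∈V∖D))
                    , cong₂ _∨_ Cw (not-injective (∧-conicalʳ (V w) _ w∈V∖D)) }
    where
    open VertexCut cut
    C : VSet m n
    C x = does (walk? (V ∖ D) (induced V) u x)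
    reached : ∀ {x} → C x ≡ true → Walk (V ∖ D) (induced V) u x
    reached {x} Cx with walk? (V ∖ D) (induced V) u x | Cx
    ... | yes walk | _ = walk
    Cu : C u ≡ true
    Cu = dec-true (walk? (V ∖ D) (induced V) u u) (here u∈V∖D)
    Cw : C w ≡ false
    Cw = dec-false (walk? (V ∖ D) (induced V) u w) u↮w
    bits : ∀ x → ((C ∪ D) x ∨ (V x ∧ not (C x))) ≡ V x × ((C ∪ D) x ∧ (V x ∧ not (C x))) ≡ D x
    bits x = cut-bits (V x) (D x) (C x) (D⊆V x) (walk-end ∘ reached)
    closed : ∀ {x y} → Adj (induced V) x y → (C ∪ D) x ≡ true → V x ∧ not (C x) ≡ false → (C ∪ D) y ≡ true
    closed {x} {y} e _ Bx with D y in Dy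
    ... | true  = ∨-zeroʳ (C y)
    ... | false = trans (∨-identityʳ (C y))
                        (dec-true (walk? (V ∖ D) (induced V) u y) (walk-snoc (reached Cx) Sy e))
      where
      Vx = proj₁ (adj-induced V e)
      Cx = not-injective (trans (sym (cong (_∧ not (C x)) Vx)) Bx)
      Sy = ∖-intro {S = V} {D} (proj₂ (adj-induced V e)) Dy

-- The induction

module _ {m n} (G : BipGraph m n) (q l : ℕ)
         (sparse : ¬ Σ (Subgraph G) λ H → KConnected (suc l) H × q ≤ card (Subgraph.V H)) where

  private
    c = l * l + l

  Bounded : ℕ → Set
  Bounded s = ∀ V a b → .{{NonZero (a + b)}} → card₁ V ≡ l + a → card₂ V ≡ l + b → a + b ≤ s →
              Bound q c (edges (induced G V)) a b

  edges-≤-shape : ∀ V {a b} → card₁ V ≡ l + a → card₂ V ≡ l + b → edges (induced G V) ≤ (l + a) * (l + b)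
  edges-≤-shape V V₁ V₂ = subst₂ (λ x y → edges (induced G V) ≤ x * y) V₁ V₂ (edges-induced-≤-product G V)

  bound-low-degree : ∀ {s V a b} → Bounded s → card₁ V ≡ l + suc a → card₂ V ≡ l + suc b →
    suc a + suc b ≤ suc s → ∀ x → V x ≡ true → degree G V x ≤ l →
    Bound q c (edges (induced G V)) (suc a) (suc b)
  bound-low-degree {V = V} {a} {b} IH V₁ V₂ size (inj₁ i) Vi low =
    bound-extendˡ {{nz}} (edges-induced-∖⁅⁆ G V (inj₁ i)) (≤-trans low (m≤n+m l (l * l)))
                  (IH (V ∖ ⁅ inj₁ i ⁆) a (suc b) {{nz}} V₁′ V₂′ (≤-pred size))
    where
    nz : NonZero (a + suc b)
    nz = >-nonZero (≤-trans (s≤s z≤n) (m≤n+m (suc b) a))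
    V₁′ = suc-injective (trans (card₁-∖⁅inj₁⁆ {S = V} Vi) (trans V₁ (+-suc l a)))
    V₂′ = trans (card₂-∖⁅inj₁⁆ {S = V} {i}) V₂
  bound-low-degree {s} {V} {a} {b} IH V₁ V₂ size (inj₂ j) Vj low =
    bound-extendʳ (edges-induced-∖⁅⁆ G V (inj₂ j)) (≤-trans low (m≤n+m l (l * l)))
                  (IH (V ∖ ⁅ inj₂ j ⁆) (suc a) b V₁′ V₂′ (subst (_≤ s) (+-suc a b) (≤-pred size)))
    where
    V₁′ = trans (card₁-∖⁅inj₂⁆ {S = V} {j}) V₁
    V₂′ = suc-injective (trans (card₂-∖⁅inj₂⁆ {S = V} Vj) (trans V₂ (+-suc l b)))

  bound-kConnected : ∀ {V a b} → .{{NonZero (a + b)}} → card₁ V ≡ l + a → card₂ V ≡ l + b →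
    KConnected (suc l) (inducedSubgraph G V) → Bound q c (edges (induced G V)) a b
  bound-kConnected {V} {a} {b} V₁ V₂ κ with q ≤? card V
  ... | yes q≤|V| = ⊥-elim (sparse (inducedSubgraph G V , κ , q≤|V|))
  ... | no  q≰|V| = bound-product {l = l} (edges-≤-shape V V₁ V₂) (inj₂ (begin
    a + b                   ≤⟨ +-mono-≤ (m≤n+m a l) (m≤n+m b l) ⟩
    (l + a) + (l + b)       ≡⟨ cong₂ _+_ V₁ V₂ ⟨
    card V                  ≤⟨ <⇒≤ (≰⇒> q≰|V|) ⟩
    q                       ∎))
    where open ≤-Reasoning

  bound-separated : ∀ {s V a b} → Bounded s → card₁ V ≡ l + a → card₂ V ≡ l + b → a + b ≤ suc s →
    MinDegree G V (suc l) → Separation G V l → Bound q c (edges (induced G V)) a b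
  bound-separated {s} {V} {a} {b} IH V₁ V₂ size δ σ =
    pieces (excess (proj₁ (sides-large G σ δ))) (excess (proj₂ (sides-large G σ δ)))
           (excess (proj₁ (sides-large G (swap G σ) δ))) (excess (proj₂ (sides-large G (swap G σ) δ)))
    where
    open Separation σ using (A; B; |A∩B|≤k)
    pieces : (∃ λ a₁ → card₁ A ≡ l + suc a₁) → (∃ λ b₁ → card₂ A ≡ l + suc b₁) →
             (∃ λ a₂ → card₁ B ≡ l + suc a₂) → (∃ λ b₂ → card₂ B ≡ l + suc b₂) →
             Bound q c (edges (induced G V)) a b
    pieces (a₁ , A₁) (b₁ , A₂) (a₂ , B₁) (b₂ , B₂) =
      bound-split (edges-induced-≤-sides G σ) a-split b-split
        (IH A (suc a₁) (suc b₁) A₁ A₂ (≤-pred (≤-trans (proj₁ smaller) size)))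
        (IH B (suc a₂) (suc b₂) B₁ B₂ (≤-pred (≤-trans (proj₂ smaller) size)))
      where
      a-split : suc a₁ + suc a₂ ≤ a
      a-split = overlap-≤ (trans (sym (cong₂ _+_ A₁ B₁)) (trans (card₁-sides G σ) (cong (_+ _) V₁)))
                          (≤-trans (m≤m+n _ _) |A∩B|≤k)
      b-split : suc b₁ + suc b₂ ≤ b
      b-split = overlap-≤ (trans (sym (cong₂ _+_ A₂ B₂)) (trans (card₂-sides G σ) (cong (_+ _) V₂)))
                          (≤-trans (m≤n+m _ _) |A∩B|≤k)
      smaller = pieces-smaller a-split b-split

  bounded : ∀ s → Bounded s
  bounded s V zero b V₁ V₂ _ = bound-product {l = l} (edges-≤-shape V V₁ V₂) (inj₁ refl)
  bounded s V (suc a) zero V₁ V₂ _ = bound-product {l = l} (edges-≤-shape V V₁ V₂) (inj₁ (*-zeroʳ (suc a)))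
  -- The bound is decidable, so the case analysis may be classical.
  bounded (suc s) V (suc a) (suc b) V₁ V₂ size = decidable-stable bound? do
    no low ← ¬¬-excluded-middle {A = ∃ λ x → V x ≡ true × degree G V x ≤ l}
      where yes (x , Vx , d≤l) → pure (bound-low-degree (bounded s) V₁ V₂ size x Vx d≤l)
    let δ : MinDegree G V (suc l)
        δ x Vx = ≰⇒> (λ d≤l → low (x , Vx , d≤l))
    no ¬cut ← ¬¬-excluded-middle {A = VertexCut G V l}
      where yes cut → pure (bound-separated (bounded s) V₁ V₂ size δ (separation G cut))
    pure (bound-kConnected V₁ V₂ (kConnected G large ¬cut))
    where
    large : suc (suc l) ≤ card V
    large = begin
      suc (suc l)                   ≡⟨ +-comm 1 (suc l) ⟩
      suc l + 1                     ≤⟨ +-mono-≤ (m<m+n l z<s) (≤-trans (s≤s z≤n) (m≤n+m (suc b) l)) ⟩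
      (l + suc a) + (l + suc b)     ≡⟨ cong₂ _+_ V₁ V₂ ⟨
      card V                        ∎
      where open ≤-Reasoning

lemma3p6 : (q l m n : ℕ) → l ≤ m → l ≤ n → suc (2 * l) ≤ m + n →
    (G : BipGraph m n) →
    ¬ (Σ (Subgraph G) (λ H → KConnected (suc l) H × q ≤ card (Subgraph.V H))) →
    edges G * (m + n ∸ 2 * l)
      ≤ q * (n ∸ l) * (m ∸ l) + (l * l + l) * (m + n ∸ 2 * l) * (m + n ∸ 2 * l)
lemma3p6 q l m n l≤m l≤n 2l<m+n G sparse =
  subst (λ s → edges G * s ≤ q * (n ∸ l) * (m ∸ l) + (l * l + l) * s * s) (sym s≡a+b)
        (Bound.≤-bound (bounded G q l sparse (a + b) (λ _ → true) a b {{nz}} whole₁ whole₂ ≤-refl))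
  where
  a = m ∸ l
  b = n ∸ l
  s≡a+b = m+n∸2*l≡[m∸l]+[n∸l] l≤m l≤n
  nz : NonZero (a + b)
  nz = >-nonZero (subst (0 <_) s≡a+b (m<n⇒0<n∸m 2l<m+n))
  whole₁ : card₁ {m} {n} (λ _ → true) ≡ l + a
  whole₁ = trans count-true (sym (m+[n∸m]≡n l≤m))
  whole₂ : card₂ {m} {n} (λ _ → true) ≡ l + b
  whole₂ = trans count-true (sym (m+[n∸m]≡n l≤n))
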